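{- Let $M=(V,D)$ be a $\Delta$-matroid. Then for all $u\in V$, \[ q_1(M)=\begin{cases}(y+1)\,q_1(M\setminus u) & \text{if } M*u\setminus u \text{ is not proper},\\ (y+1)\,q_1(M*u\setminus u) & \text{if } M\setminus u \text{ is not proper},\\ q_1(M\setminus u)+q_1(M*u\setminus u) & \text{otherwise,}\end{cases}\] and $q_1(M)=1$ if $M=(\emptyset,\{\emptyset\})$.
   Context: A set system is $M=(V,D)$ with $V$ finite, $D$ a family of subsets of $V$; write $Z\in M$ for $Z\in D$; proper means $D\neq\emptyset$. $\oplus$ is symmetric difference. $M*X=(V,\{Z\oplus X:Z\in D\})$; $M\setminus u=(V\setminus\{u\},\{Z\in D:u\notin Z\})$; operations apply left to right. For proper $M$, $d_M(X)=\min\{|X\oplus Z|:Z\in M\}$, $d_M=d_M(\emptyset)$, and $q_1(M)=\sum_{X\subseteq V}y^{d_{M*X}}$. A $\Delta$-matroid is a proper set system such that for all $X,Y\in M$ and $w\in X\oplus Y$, either $X\oplus\{w\}\in M$ or some $v\in X\oplus Y$, $v\neq w$, has $X\oplus\{w,v\}\in M$. -}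

module Defs where

open import Level using (Level)
open import Data.Nat using (ℕ; zero; suc; _⊓_)
open import Data.Bool using (Bool; true; false; _xor_; _∧_; _∨_; not)
open import Data.Fin using (Fin)
open import Data.Fin.Subset using (Subset; ⁅_⁆; _∈_; _⊆_; _∪_; _-_; ∣_∣; ⊥; inside; outside)
open import Data.Vec using (Vec; []; _∷_; zipWith; foldr′; lookup)
open import Data.List using (List; []; _∷_; map; filterᵇ; foldr; _++_)
open import Data.Product using (∃; _×_)
open import Data.Sum using (_⊎_)
open import Relation.Binary.PropositionalEquality using (_≡_; _≢_)
open import Algebra.Bundles using (CommutativeSemiring)

private variable n : ℕ

_⊕_ : Subset n → Subset n → Subset n
_⊕_ = zipWith _xor_

allSubsets : (n : ℕ) → List (Subset n)
allSubsets zero = [] ∷ []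
allSubsets (suc n) = map (inside ∷_) (allSubsets n) ++ map (outside ∷_) (allSubsets n)

_⊆ᵇ_ : Subset n → Subset n → Bool
X ⊆ᵇ Y = foldr′ _∧_ true (zipWith (λ a b → not a ∨ b) X Y)

-- A set system M = (V, D): the ground set V is a subset of the universe Fin n,
-- and D is given by its (decidable) membership predicate.
record SetSystem (n : ℕ) : Set where
  constructor mkSS
  field
    V : Subset n
    D : Subset n → Bool
open SetSystem public

_∈M_ : Subset n → SetSystem n → Set
Z ∈M M = D M Z ≡ true

WellFormed : SetSystem n → Set
WellFormed M = ∀ Z → Z ∈M M → Z ⊆ V M

Proper : SetSystem n → Set
Proper M = ∃ λ Z → Z ∈M M

_⋆_ : SetSystem n → Subset n → SetSystem n
M ⋆ X = mkSS (V M) (λ Z → D M (Z ⊕ X))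

_∖_ : SetSystem n → Fin n → SetSystem n
M ∖ u = mkSS (V M - u) (λ Z → not (lookup Z u) ∧ D M Z)

infixl 6 _⋆_ _∖_

-- minimum of a list (the default value is only used for an empty list)
minOr : ℕ → List ℕ → ℕ
minOr d [] = d
minOr d (x ∷ xs) = foldr _⊓_ x xs

-- d_M(X) = min { |X ⊕ Z| : Z ∈ M }  (meaningful for proper M)
dist : SetSystem n → Subset n → ℕ
dist {n} M X = minOr 0 (map (λ Z → ∣ X ⊕ Z ∣) (filterᵇ (D M) (allSubsets n)))

d : SetSystem n → ℕ
d M = dist M ⊥

record IsDeltaMatroid (M : SetSystem n) : Set where
  field
    wellFormed : WellFormed M
    proper     : Proper M
    exchange   : ∀ X Y → X ∈M M → Y ∈M M → ∀ w → w ∈ (X ⊕ Y) →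
                 ((X ⊕ ⁅ w ⁆) ∈M M)
                 ⊎ (∃ λ v → v ∈ (X ⊕ Y) × v ≢ w × ((X ⊕ (⁅ w ⁆ ∪ ⁅ v ⁆)) ∈M M))

-- The polynomial q₁(M) = Σ_{X ⊆ V} y^{d_{M*X}}, evaluated at an element y of an
-- arbitrary commutative semiring R.  (A polynomial identity in ℕ[y] is the same
-- as the identity holding for all R and y.)
module Poly {c ℓ : Level} (R : CommutativeSemiring c ℓ) where
  open CommutativeSemiring R

  pow : Carrier → ℕ → Carrier
  pow y zero = 1#
  pow y (suc k) = y * pow y k

  q₁ : Carrier → SetSystem n → Carrier
  q₁ {n} y M = foldr (λ X acc → pow y (d (M ⋆ X)) + acc) 0#
                     (filterᵇ (λ X → X ⊆ᵇ V M) (allSubsets n))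

-- Fix u ∈ V and X ⊆ V with u ∉ X. A member W of M either avoids u, and then it is a
-- member of M \ u, or contains u, and then W ⊕ {u} is a member of M * u \ u. So with
-- a = d_{M\u*X} and b = d_{M*u\u*X} we get d_{M*X} = min(a, b + 1) and
-- d_{M*(X⊕u)} = min(a + 1, b), where a minor that is not proper does not contribute.
-- If one minor is not proper, the pair {X, X ⊕ u} contributes y^a + y^(a+1) = (y + 1) y^a
-- (or the same with b). If both are proper, the exchange axiom at u, applied to members
-- realising a and b, gives |a − b| ≤ 1, so the pair contributes y^a + y^b. Summing over
-- all such pairs gives the recursion; for the trivial Δ-matroid d_{M*∅} = 0.

module Submission where

open import Defs
open import Level using (Level)
open import Algebra.Bundles using (CommutativeSemiring)
open import Data.Nat using (ℕ; zero; suc; _≤_; _⊓_; s≤s)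
open import Data.Nat.Properties
  using (≤-reflexive; ≤-trans; ≤-antisym; n≤1+n; n≤0⇒n≡0; ⊓-sel; m≤n⇒m⊓o≤n; m≤n⇒o⊓m≤n)
open import Data.Bool using (Bool; true; false; not; _xor_; _∧_; _∨_; if_then_else_; T?)
open import Data.Bool.Properties
  using (xor-assoc; xor-comm; xor-identityˡ; xor-identityʳ; xor-same; xor-inverseˡ; ¬-not; T-≡; ∧-zeroʳ)
open import Data.Fin using (Fin; zero; suc)
open import Data.Fin.Subset using (Subset; ⊥; ⁅_⁆; _∈_; _∪_; _-_; ∣_∣; inside; outside)
open import Data.Fin.Subset.Properties using (x∈⁅x⁆; x≢y⇒x∉⁅y⁆; ∪-identityˡ; ∪-identityʳ; p─⊥≡p; ∣⊥∣≡0)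
open import Data.Vec using ([]; _∷_; lookup)
open import Data.Vec.Properties
  using (zipWith-assoc; zipWith-comm; zipWith-identityˡ; zipWith-identityʳ; zipWith-inverseˡ;
         map-id; lookup-zipWith; lookup-replicate; []=⇒lookup; lookup⇒[]=)
open import Data.List using (List; []; _∷_; map; _++_; foldr; filterᵇ)
open import Data.List.Properties using (foldr-preservesᵒ; foldr-map)
open import Data.List.Membership.Propositional using () renaming (_∈_ to _∈ˡ_)
open import Data.List.Membership.Propositional.Properties
  using (∈-map⁺; ∈-map⁻; ∈-++⁺ˡ; ∈-++⁺ʳ; ∈-filter⁺; ∈-filter⁻; foldr-selective)
open import Data.List.Relation.Unary.Any as Any using (here; there)
open import Data.Empty using (⊥-elim)
open import Data.Product using (∃; _×_; _,_; proj₂)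
open import Data.Sum using (_⊎_; inj₁; inj₂; [_,_])
open import Function using (_∘_; Equivalence)
open import Relation.Nullary using (¬_)
open import Relation.Binary.PropositionalEquality
  using (_≡_; _≢_; refl; sym; trans; cong; cong₂; subst; subst₂; module ≡-Reasoning)

private variable n : ℕ

-- Symmetric difference

⊕-assoc : (X Y Z : Subset n) → (X ⊕ Y) ⊕ Z ≡ X ⊕ (Y ⊕ Z)
⊕-assoc = zipWith-assoc xor-assoc

⊕-comm : (X Y : Subset n) → X ⊕ Y ≡ Y ⊕ X
⊕-comm = zipWith-comm xor-comm

⊕-identityˡ : (X : Subset n) → ⊥ ⊕ X ≡ X
⊕-identityˡ = zipWith-identityˡ xor-identityˡ

⊕-identityʳ : (X : Subset n) → X ⊕ ⊥ ≡ X
⊕-identityʳ = zipWith-identityʳ xor-identityʳ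

⊕-self : (X : Subset n) → X ⊕ X ≡ ⊥
⊕-self X = trans (cong (_⊕ X) (sym (map-id X))) (zipWith-inverseˡ xor-same X)

⊕-cancelʳ : (X Y : Subset n) → (X ⊕ Y) ⊕ Y ≡ X
⊕-cancelʳ X Y = begin
  (X ⊕ Y) ⊕ Y  ≡⟨ ⊕-assoc X Y Y ⟩
  X ⊕ (Y ⊕ Y)  ≡⟨ cong (X ⊕_) (⊕-self Y) ⟩
  X ⊕ ⊥        ≡⟨ ⊕-identityʳ X ⟩
  X            ∎
  where open ≡-Reasoning

⊕-swapʳ : (X Y Z : Subset n) → (X ⊕ Y) ⊕ Z ≡ (X ⊕ Z) ⊕ Y
⊕-swapʳ X Y Z = begin
  (X ⊕ Y) ⊕ Z  ≡⟨ ⊕-assoc X Y Z ⟩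
  X ⊕ (Y ⊕ Z)  ≡⟨ cong (X ⊕_) (⊕-comm Y Z) ⟩
  X ⊕ (Z ⊕ Y)  ≡⟨ ⊕-assoc X Z Y ⟨
  (X ⊕ Z) ⊕ Y  ∎
  where open ≡-Reasoning

⊕-cancel-common : (X Y Z : Subset n) → (X ⊕ Z) ⊕ (Y ⊕ Z) ≡ X ⊕ Y
⊕-cancel-common X Y Z = begin
  (X ⊕ Z) ⊕ (Y ⊕ Z)  ≡⟨ cong ((X ⊕ Z) ⊕_) (⊕-comm Y Z) ⟩
  (X ⊕ Z) ⊕ (Z ⊕ Y)  ≡⟨ ⊕-assoc (X ⊕ Z) Z Y ⟨
  ((X ⊕ Z) ⊕ Z) ⊕ Y  ≡⟨ cong (_⊕ Y) (⊕-cancelʳ X Z) ⟩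
  X ⊕ Y              ∎
  where open ≡-Reasoning

⊕-cancel-inner : (W Y Z F : Subset n) → (W ⊕ (Z ⊕ F)) ⊕ (Y ⊕ Z) ≡ (W ⊕ Y) ⊕ F
⊕-cancel-inner W Y Z F = begin
  (W ⊕ (Z ⊕ F)) ⊕ (Y ⊕ Z)  ≡⟨ cong (λ T → (W ⊕ T) ⊕ (Y ⊕ Z)) (⊕-comm Z F) ⟩
  (W ⊕ (F ⊕ Z)) ⊕ (Y ⊕ Z)  ≡⟨ cong (_⊕ (Y ⊕ Z)) (⊕-assoc W F Z) ⟨
  ((W ⊕ F) ⊕ Z) ⊕ (Y ⊕ Z)  ≡⟨ ⊕-cancel-common (W ⊕ F) Y Z ⟩
  (W ⊕ F) ⊕ Y              ≡⟨ ⊕-swapʳ W F Y ⟩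
  (W ⊕ Y) ⊕ F              ∎
  where open ≡-Reasoning

lookup-⊕ : (X Y : Subset n) (u : Fin n) → lookup (X ⊕ Y) u ≡ (lookup X u xor lookup Y u)
lookup-⊕ X Y u = lookup-zipWith _ u X Y

lookup-⁅⁆ : (u : Fin n) → lookup ⁅ u ⁆ u ≡ true
lookup-⁅⁆ u = []=⇒lookup (x∈⁅x⁆ u)

lookup-⁅⁆-≢ : {u v : Fin n} → v ≢ u → lookup ⁅ v ⁆ u ≡ false
lookup-⁅⁆-≢ {u = u} {v} v≢u = ¬-not (x≢y⇒x∉⁅y⁆ (v≢u ∘ sym) ∘ lookup⇒[]= u ⁅ v ⁆)

lookup-⊥ : (u : Fin n) → lookup ⊥ u ≡ false
lookup-⊥ u = lookup-replicate u false

lookup-⊕⁅⁆ : (X : Subset n) (u : Fin n) → lookup (X ⊕ ⁅ u ⁆) u ≡ not (lookup X u)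
lookup-⊕⁅⁆ X u = begin
  lookup (X ⊕ ⁅ u ⁆) u          ≡⟨ lookup-⊕ X ⁅ u ⁆ u ⟩
  lookup X u xor lookup ⁅ u ⁆ u ≡⟨ cong (lookup X u xor_) (lookup-⁅⁆ u) ⟩
  lookup X u xor true           ≡⟨ xor-comm (lookup X u) true ⟩
  not (lookup X u)              ∎
  where open ≡-Reasoning

⁅⁆∪⁅⁆≡⁅⁆⊕⁅⁆ : {u v : Fin n} → u ≢ v → ⁅ u ⁆ ∪ ⁅ v ⁆ ≡ ⁅ u ⁆ ⊕ ⁅ v ⁆
⁅⁆∪⁅⁆≡⁅⁆⊕⁅⁆ {u = zero}  {zero}  u≢v = ⊥-elim (u≢v refl)
⁅⁆∪⁅⁆≡⁅⁆⊕⁅⁆ {u = zero}  {suc v} _   = cong (inside ∷_) (trans (∪-identityˡ ⁅ v ⁆) (sym (⊕-identityˡ ⁅ v ⁆)))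
⁅⁆∪⁅⁆≡⁅⁆⊕⁅⁆ {u = suc u} {zero}  _   = cong (inside ∷_) (trans (∪-identityʳ ⁅ u ⁆) (sym (⊕-identityʳ ⁅ u ⁆)))
⁅⁆∪⁅⁆≡⁅⁆⊕⁅⁆ {u = suc u} {suc v} u≢v = cong (outside ∷_) (⁅⁆∪⁅⁆≡⁅⁆⊕⁅⁆ (u≢v ∘ cong suc))

lookup-⊕⁅⁆⊕ : (W F : Subset n) (u : Fin n) → lookup F u ≡ false →
              lookup (W ⊕ (⁅ u ⁆ ⊕ F)) u ≡ not (lookup W u)
lookup-⊕⁅⁆⊕ W F u u∉F = begin
  lookup (W ⊕ (⁅ u ⁆ ⊕ F)) u                ≡⟨ lookup-⊕ W (⁅ u ⁆ ⊕ F) u ⟩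
  lookup W u xor lookup (⁅ u ⁆ ⊕ F) u       ≡⟨ cong (lookup W u xor_) (lookup-⊕ ⁅ u ⁆ F u) ⟩
  lookup W u xor (lookup ⁅ u ⁆ u xor lookup F u) ≡⟨ cong (λ b → lookup W u xor b) (cong₂ _xor_ (lookup-⁅⁆ u) u∉F) ⟩
  lookup W u xor true                       ≡⟨ xor-comm (lookup W u) true ⟩
  not (lookup W u)                          ∎
  where open ≡-Reasoning

∈-⊕⁺ : {W W′ : Subset n} {u : Fin n} → lookup W u ≡ not (lookup W′ u) → u ∈ W ⊕ W′
∈-⊕⁺ {W = W} {W′} {u} eq =
  lookup⇒[]= u (W ⊕ W′) (trans (lookup-⊕ W W′ u) (trans (cong (_xor lookup W′ u) eq) (xor-inverseˡ (lookup W′ u))))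

lookup-⊕-∉ : (W : Subset n) {X : Subset n} {u : Fin n} → lookup X u ≡ false → lookup (W ⊕ X) u ≡ lookup W u
lookup-⊕-∉ W {X} {u} u∉X = trans (lookup-⊕ W X u) (trans (cong (lookup W u xor_) u∉X) (xor-comm _ false))

⊆ᵇ-remove : (X W : Subset n) (u : Fin n) → lookup X u ≡ false → X ⊆ᵇ (W - u) ≡ X ⊆ᵇ W
⊆ᵇ-remove (outside ∷ X) (w ∷ W) zero    _   = cong (X ⊆ᵇ_) (p─⊥≡p W)
⊆ᵇ-remove (x ∷ X)       (w ∷ W) (suc u) u∉X = cong ((not x ∨ w) ∧_) (⊆ᵇ-remove X W u u∉X)

⊆ᵇ-⊕⁅⁆ : (X W : Subset n) (u : Fin n) → lookup X u ≡ false → lookup W u ≡ true →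
         (X ⊕ ⁅ u ⁆) ⊆ᵇ W ≡ X ⊆ᵇ W
⊆ᵇ-⊕⁅⁆ (outside ∷ X) (inside ∷ W) zero    _   _   = cong (_⊆ᵇ W) (⊕-identityʳ X)
⊆ᵇ-⊕⁅⁆ (x ∷ X)       (w ∷ W)      (suc u) u∉X u∈W =
  cong₂ (λ a b → (not a ∨ w) ∧ b) (xor-identityʳ x) (⊆ᵇ-⊕⁅⁆ X W u u∉X u∈W)

⊕⁅⁆-⊆ᵇ-remove : (X W : Subset n) (u : Fin n) → lookup X u ≡ false → (X ⊕ ⁅ u ⁆) ⊆ᵇ (W - u) ≡ false
⊕⁅⁆-⊆ᵇ-remove (outside ∷ X) (w ∷ W) zero    _   = refl
⊕⁅⁆-⊆ᵇ-remove (x ∷ X)       (w ∷ W) (suc u) u∉X =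
  trans (cong (_ ∧_) (⊕⁅⁆-⊆ᵇ-remove X W u u∉X)) (∧-zeroʳ _)

∣⊕⁅⁆∣-∉ : (Z : Subset n) (u : Fin n) → lookup Z u ≡ false → ∣ Z ⊕ ⁅ u ⁆ ∣ ≡ suc ∣ Z ∣
∣⊕⁅⁆∣-∉ (outside ∷ Z) zero    _   = cong suc (cong ∣_∣ (⊕-identityʳ Z))
∣⊕⁅⁆∣-∉ (inside  ∷ Z) (suc u) u∉Z = cong suc (∣⊕⁅⁆∣-∉ Z u u∉Z)
∣⊕⁅⁆∣-∉ (outside ∷ Z) (suc u) u∉Z = ∣⊕⁅⁆∣-∉ Z u u∉Z

∣⊕⁅⁆∣-∈ : (Z : Subset n) (u : Fin n) → lookup Z u ≡ true → suc ∣ Z ⊕ ⁅ u ⁆ ∣ ≡ ∣ Z ∣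
∣⊕⁅⁆∣-∈ (inside  ∷ Z) zero    _   = cong suc (cong ∣_∣ (⊕-identityʳ Z))
∣⊕⁅⁆∣-∈ (inside  ∷ Z) (suc u) u∈Z = cong suc (∣⊕⁅⁆∣-∈ Z u u∈Z)
∣⊕⁅⁆∣-∈ (outside ∷ Z) (suc u) u∈Z = ∣⊕⁅⁆∣-∈ Z u u∈Z

∣⊕⁅⁆∣≤ : (Z : Subset n) (u : Fin n) → ∣ Z ⊕ ⁅ u ⁆ ∣ ≤ suc ∣ Z ∣
∣⊕⁅⁆∣≤ Z u with lookup Z u in eq
... | false = ≤-reflexive (∣⊕⁅⁆∣-∉ Z u eq)
... | true  = ≤-trans (n≤1+n _) (≤-trans (≤-reflexive (∣⊕⁅⁆∣-∈ Z u eq)) (n≤1+n _))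

∣⊕⊕⁅⁆∣-∉ : (W X : Subset n) (u : Fin n) → lookup X u ≡ false → lookup W u ≡ false →
           ∣ W ⊕ (X ⊕ ⁅ u ⁆) ∣ ≡ suc ∣ W ⊕ X ∣
∣⊕⊕⁅⁆∣-∉ W X u u∉X u∉W =
  trans (cong ∣_∣ (sym (⊕-assoc W X ⁅ u ⁆))) (∣⊕⁅⁆∣-∉ (W ⊕ X) u (trans (lookup-⊕-∉ W u∉X) u∉W))

∣⊕⊕⁅⁆∣-∈ : (W X : Subset n) (u : Fin n) → lookup X u ≡ false → lookup W u ≡ true →
           suc ∣ W ⊕ (X ⊕ ⁅ u ⁆) ∣ ≡ ∣ W ⊕ X ∣
∣⊕⊕⁅⁆∣-∈ W X u u∉X u∈W =
  trans (cong (suc ∘ ∣_∣) (sym (⊕-assoc W X ⁅ u ⁆))) (∣⊕⁅⁆∣-∈ (W ⊕ X) u (trans (lookup-⊕-∉ W u∉X) u∈W))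

-- Distances

∈-∖⁺ : {S : SetSystem n} {u : Fin n} {Z : Subset n} →
       lookup Z u ≡ false → Z ∈M S → Z ∈M (S ∖ u)
∈-∖⁺ u∉Z Z∈S rewrite u∉Z = Z∈S

∈-∖⁻ : {S : SetSystem n} {u : Fin n} (Z : Subset n) →
       Z ∈M (S ∖ u) → lookup Z u ≡ false × Z ∈M S
∈-∖⁻ {u = u} Z Z∈S∖u with lookup Z u
... | false = refl , Z∈S∖u

⊕-∈-⋆ : {S : SetSystem n} (Y : Subset n) {W : Subset n} → W ∈M S → (W ⊕ Y) ∈M (S ⋆ Y)
⊕-∈-⋆ {S = S} Y {W} = subst (λ Z → D S Z ≡ true) (sym (⊕-cancelʳ W Y))

∈-allSubsets : (Z : Subset n) → Z ∈ˡ allSubsets n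
∈-allSubsets []            = here refl
∈-allSubsets (inside  ∷ Z) = ∈-++⁺ˡ (∈-map⁺ (inside ∷_) (∈-allSubsets Z))
∈-allSubsets {suc n} (outside ∷ Z) =
  ∈-++⁺ʳ (map (inside ∷_) (allSubsets n)) (∈-map⁺ (outside ∷_) (∈-allSubsets Z))

minOr-≤ : ∀ {z} e (xs : List ℕ) → z ∈ˡ xs → minOr e xs ≤ z
minOr-≤ {z} _ (x ∷ xs) z∈ = foldr-preservesᵒ ⊓-≤ x xs (split z∈)
  where
  ⊓-≤ : ∀ a b → a ≤ z ⊎ b ≤ z → a ⊓ b ≤ z
  ⊓-≤ a b = [ m≤n⇒m⊓o≤n b , m≤n⇒o⊓m≤n a ]
  split : z ∈ˡ x ∷ xs → x ≤ z ⊎ Any.Any (_≤ z) xs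
  split (here z≡x)  = inj₁ (≤-reflexive (sym z≡x))
  split (there z∈′) = inj₂ (Any.map (≤-reflexive ∘ sym) z∈′)

minOr-∈ : ∀ {z} e (xs : List ℕ) → z ∈ˡ xs → minOr e xs ∈ˡ xs
minOr-∈ _ (x ∷ xs) _ with foldr-selective ⊓-sel x xs
... | inj₁ min≡x = here min≡x
... | inj₂ min∈xs = there min∈xs

module _ (S : SetSystem n) where

  private
    members = filterᵇ (D S) (allSubsets n)
    sizes = map (λ Z → ∣ ⊥ ⊕ Z ∣) members

    size∈sizes : {Z : Subset n} → Z ∈M S → ∣ Z ∣ ∈ˡ sizes
    size∈sizes {Z} Z∈S = subst (_∈ˡ sizes) (cong ∣_∣ (⊕-identityˡ Z))
      (∈-map⁺ (λ Z → ∣ ⊥ ⊕ Z ∣) (∈-filter⁺ (T? ∘ D S) (∈-allSubsets Z) (Equivalence.from T-≡ Z∈S)))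

  d-≤ : {Z : Subset n} → Z ∈M S → d S ≤ ∣ Z ∣
  d-≤ Z∈S = minOr-≤ 0 sizes (size∈sizes Z∈S)

  d-attained : Proper S → ∃ λ Z → Z ∈M S × d S ≡ ∣ Z ∣
  d-attained (Z₀ , Z₀∈S) with ∈-map⁻ (λ Z → ∣ ⊥ ⊕ Z ∣) (minOr-∈ 0 sizes (size∈sizes Z₀∈S))
  ... | Z , Z∈members , d≡ =
    Z , Equivalence.to T-≡ (proj₂ (∈-filter⁻ (T? ∘ D S) {xs = allSubsets n} Z∈members)) ,
    trans d≡ (cong ∣_∣ (⊕-identityˡ Z))

d-⋆-≤ : (S : SetSystem n) (Y : Subset n) {W : Subset n} → W ∈M S → d (S ⋆ Y) ≤ ∣ W ⊕ Y ∣
d-⋆-≤ S Y W∈S = d-≤ (S ⋆ Y) (⊕-∈-⋆ {S = S} Y W∈S)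

d-⋆-attained : (S : SetSystem n) (Y : Subset n) → Proper S →
               ∃ λ W → W ∈M S × d (S ⋆ Y) ≡ ∣ W ⊕ Y ∣
d-⋆-attained S Y (W₀ , W₀∈S) with d-attained (S ⋆ Y) (W₀ ⊕ Y , ⊕-∈-⋆ {S = S} Y W₀∈S)
... | Z , Z⊕Y∈S , d≡ = Z ⊕ Y , Z⊕Y∈S , trans d≡ (cong ∣_∣ (sym (⊕-cancelʳ Z Y)))

d-⋆-≡ : (S : SetSystem n) (Y : Subset n) {k : ℕ} →
        (∀ W → W ∈M S → k ≤ ∣ W ⊕ Y ∣) → (W₀ : Subset n) → W₀ ∈M S → ∣ W₀ ⊕ Y ∣ ≡ k →
        d (S ⋆ Y) ≡ k
d-⋆-≡ S Y {k} k≤ W₀ W₀∈S ∣W₀⊕Y∣≡k with d-⋆-attained S Y (W₀ , W₀∈S)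
... | W , W∈S , d≡ = ≤-antisym (subst (d (S ⋆ Y) ≤_) ∣W₀⊕Y∣≡k (d-⋆-≤ S Y W₀∈S))
                               (subst (k ≤_) (sym d≡) (k≤ W W∈S))

-- W″ is W with u toggled and at most one further element toggled.
exchange-flip : {M : SetSystem n} → IsDeltaMatroid M → {W W′ : Subset n} → W ∈M M → W′ ∈M M →
                {u : Fin n} → u ∈ W ⊕ W′ →
                ∃ λ W″ → W″ ∈M M × lookup W″ u ≡ not (lookup W u)
                       × (∀ Y → ∣ W″ ⊕ (Y ⊕ ⁅ u ⁆) ∣ ≤ suc ∣ W ⊕ Y ∣)
exchange-flip {M = M} dm {W} {W′} W∈M W′∈M {u} u∈W⊕W′
  with IsDeltaMatroid.exchange dm W W′ W∈M W′∈M u u∈W⊕W′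
... | inj₁ W⊕u∈M =
  W ⊕ (⁅ u ⁆ ⊕ ⊥) ,
  subst (λ F → (W ⊕ F) ∈M M) (sym (⊕-identityʳ ⁅ u ⁆)) W⊕u∈M ,
  lookup-⊕⁅⁆⊕ W ⊥ u (lookup-⊥ u) ,
  λ Y → ≤-trans (≤-reflexive (cong ∣_∣ (trans (⊕-cancel-inner W Y ⁅ u ⁆ ⊥) (⊕-identityʳ (W ⊕ Y))))) (n≤1+n _)
... | inj₂ (v , _ , v≢u , W⊕uv∈M) =
  W ⊕ (⁅ u ⁆ ⊕ ⁅ v ⁆) ,
  subst (λ F → (W ⊕ F) ∈M M) (⁅⁆∪⁅⁆≡⁅⁆⊕⁅⁆ (v≢u ∘ sym)) W⊕uv∈M ,
  lookup-⊕⁅⁆⊕ W ⁅ v ⁆ u (lookup-⁅⁆-≢ v≢u) ,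
  λ Y → ≤-trans (≤-reflexive (cong ∣_∣ (⊕-cancel-inner W Y ⁅ u ⁆ ⁅ v ⁆))) (∣⊕⁅⁆∣≤ (W ⊕ Y) v)

-- The minors M \ u and M * u \ u

module _ (M : SetSystem n) (u : Fin n) where

  ⊕⁅⁆-∈-⋆∖ : {W : Subset n} → W ∈M M → lookup W u ≡ true → (W ⊕ ⁅ u ⁆) ∈M (M ⋆ ⁅ u ⁆ ∖ u)
  ⊕⁅⁆-∈-⋆∖ {W} W∈M u∈W =
    ∈-∖⁺ {S = M ⋆ ⁅ u ⁆} (trans (lookup-⊕⁅⁆ W u) (cong not u∈W)) (⊕-∈-⋆ {S = M} ⁅ u ⁆ W∈M)

  proper-∖ : Proper M → ¬ Proper (M ⋆ ⁅ u ⁆ ∖ u) → Proper (M ∖ u)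
  proper-∖ (W , W∈M) ¬B with lookup W u in eq
  ... | false = W , ∈-∖⁺ {S = M} eq W∈M
  ... | true  = ⊥-elim (¬B (_ , ⊕⁅⁆-∈-⋆∖ W∈M eq))

  proper-⋆∖ : Proper M → ¬ Proper (M ∖ u) → Proper (M ⋆ ⁅ u ⁆ ∖ u)
  proper-⋆∖ (W , W∈M) ¬A with lookup W u in eq
  ... | false = ⊥-elim (¬A (W , ∈-∖⁺ {S = M} eq W∈M))
  ... | true  = _ , ⊕⁅⁆-∈-⋆∖ W∈M eq

  ≤-on-members : {k : ℕ} (f : Subset n → ℕ) →
                 (∀ {W} → W ∈M M → lookup W u ≡ false → k ≤ f W) →
                 (∀ {W} → W ∈M M → lookup W u ≡ true → k ≤ f W) →
                 ∀ W → W ∈M M → k ≤ f W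
  ≤-on-members f ≤-∉ ≤-∈ W W∈M with lookup W u in eq
  ... | false = ≤-∉ W∈M eq
  ... | true  = ≤-∈ W∈M eq

  module _ (X : Subset n) where

    d-∖-≤ : {W : Subset n} → W ∈M M → lookup W u ≡ false → d (M ∖ u ⋆ X) ≤ ∣ W ⊕ X ∣
    d-∖-≤ W∈M u∉W = d-⋆-≤ (M ∖ u) X (∈-∖⁺ {S = M} u∉W W∈M)

    d-⋆∖-≤ : {W : Subset n} → W ∈M M → lookup W u ≡ true →
             d (M ⋆ ⁅ u ⁆ ∖ u ⋆ X) ≤ ∣ W ⊕ (X ⊕ ⁅ u ⁆) ∣
    d-⋆∖-≤ {W} W∈M u∈W = subst (_ ≤_) (cong ∣_∣ rotate) (d-⋆-≤ (M ⋆ ⁅ u ⁆ ∖ u) X (⊕⁅⁆-∈-⋆∖ W∈M u∈W))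
      where
      rotate : (W ⊕ ⁅ u ⁆) ⊕ X ≡ W ⊕ (X ⊕ ⁅ u ⁆)
      rotate = trans (⊕-assoc W ⁅ u ⁆ X) (cong (W ⊕_) (⊕-comm ⁅ u ⁆ X))

    d-∖-attained : Proper (M ∖ u) →
                   ∃ λ W → W ∈M M × lookup W u ≡ false × d (M ∖ u ⋆ X) ≡ ∣ W ⊕ X ∣
    d-∖-attained pA with d-⋆-attained (M ∖ u) X pA
    ... | W , W∈M∖u , d≡ with ∈-∖⁻ {S = M} W W∈M∖u
    ... | u∉W , W∈M = W , W∈M , u∉W , d≡

    d-⋆∖-attained : Proper (M ⋆ ⁅ u ⁆ ∖ u) →
                    ∃ λ W → W ∈M M × lookup W u ≡ true × d (M ⋆ ⁅ u ⁆ ∖ u ⋆ X) ≡ ∣ W ⊕ (X ⊕ ⁅ u ⁆) ∣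
    d-⋆∖-attained pB with d-⋆-attained (M ⋆ ⁅ u ⁆ ∖ u) X pB
    ... | Z , Z∈M⋆u∖u , d≡ with ∈-∖⁻ {S = M ⋆ ⁅ u ⁆} Z Z∈M⋆u∖u
    ... | u∉Z , Z⊕u∈M =
      Z ⊕ ⁅ u ⁆ , Z⊕u∈M , trans (lookup-⊕⁅⁆ Z u) (cong not u∉Z) ,
      trans d≡ (cong ∣_∣ (sym (⊕-cancel-common Z X ⁅ u ⁆)))

    d-⋆∖-≤-suc-d-∖ : IsDeltaMatroid M → Proper (M ∖ u) → Proper (M ⋆ ⁅ u ⁆ ∖ u) →
                      d (M ⋆ ⁅ u ⁆ ∖ u ⋆ X) ≤ suc (d (M ∖ u ⋆ X))
    d-⋆∖-≤-suc-d-∖ dm pA pB with d-∖-attained pA | d-⋆∖-attained pB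
    ... | Wa , Wa∈M , u∉Wa , dA≡ | Wb , Wb∈M , u∈Wb , _
      with exchange-flip dm Wa∈M Wb∈M (∈-⊕⁺ (trans u∉Wa (sym (cong not u∈Wb))))
    ... | W , W∈M , u∈W , near =
      ≤-trans (d-⋆∖-≤ W∈M (trans u∈W (cong not u∉Wa)))
              (subst (λ k → _ ≤ suc k) (sym dA≡) (near X))

    d-∖-≤-suc-d-⋆∖ : IsDeltaMatroid M → Proper (M ∖ u) → Proper (M ⋆ ⁅ u ⁆ ∖ u) →
                      d (M ∖ u ⋆ X) ≤ suc (d (M ⋆ ⁅ u ⁆ ∖ u ⋆ X))
    d-∖-≤-suc-d-⋆∖ dm pA pB with d-∖-attained pA | d-⋆∖-attained pB
    ... | Wa , Wa∈M , u∉Wa , _ | Wb , Wb∈M , u∈Wb , dB≡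
      with exchange-flip dm Wb∈M Wa∈M (∈-⊕⁺ (trans u∈Wb (sym (cong not u∉Wa))))
    ... | W , W∈M , u∉W , near =
      ≤-trans (d-∖-≤ W∈M (trans u∉W (cong not u∈Wb)))
              (subst₂ (λ j k → j ≤ suc k) (cong ∣_∣ (cong (W ⊕_) (⊕-cancelʳ X ⁅ u ⁆))) (sym dB≡)
                      (near (X ⊕ ⁅ u ⁆)))

    module _ (u∉X : lookup X u ≡ false) where

      suc-d-∖-≤ : {W : Subset n} → W ∈M M → lookup W u ≡ false →
                  suc (d (M ∖ u ⋆ X)) ≤ ∣ W ⊕ (X ⊕ ⁅ u ⁆) ∣
      suc-d-∖-≤ {W} W∈M u∉W = subst (_ ≤_) (sym (∣⊕⊕⁅⁆∣-∉ W X u u∉X u∉W)) (s≤s (d-∖-≤ W∈M u∉W))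

      suc-d-⋆∖-≤ : {W : Subset n} → W ∈M M → lookup W u ≡ true →
                   suc (d (M ⋆ ⁅ u ⁆ ∖ u ⋆ X)) ≤ ∣ W ⊕ X ∣
      suc-d-⋆∖-≤ {W} W∈M u∈W = subst (_ ≤_) (∣⊕⊕⁅⁆∣-∈ W X u u∉X u∈W) (s≤s (d-⋆∖-≤ W∈M u∈W))

      d-twists-¬⋆∖ : Proper M → ¬ Proper (M ⋆ ⁅ u ⁆ ∖ u) →
                     d (M ⋆ X) ≡ d (M ∖ u ⋆ X) × d (M ⋆ (X ⊕ ⁅ u ⁆)) ≡ suc (d (M ∖ u ⋆ X))
      d-twists-¬⋆∖ pM ¬pB with d-∖-attained (proper-∖ pM ¬pB)
      ... | Wa , Wa∈M , u∉Wa , dA≡ =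
        d-⋆-≡ M X (≤-on-members _ d-∖-≤ absurd) Wa Wa∈M (sym dA≡) ,
        d-⋆-≡ M (X ⊕ ⁅ u ⁆) (≤-on-members _ suc-d-∖-≤ absurd) Wa Wa∈M
              (trans (∣⊕⊕⁅⁆∣-∉ Wa X u u∉X u∉Wa) (cong suc (sym dA≡)))
        where
        absurd : {A : Set} {W : Subset n} → W ∈M M → lookup W u ≡ true → A
        absurd W∈M u∈W = ⊥-elim (¬pB (_ , ⊕⁅⁆-∈-⋆∖ W∈M u∈W))

      d-twists-¬∖ : Proper M → ¬ Proper (M ∖ u) →
                    d (M ⋆ X) ≡ suc (d (M ⋆ ⁅ u ⁆ ∖ u ⋆ X)) × d (M ⋆ (X ⊕ ⁅ u ⁆)) ≡ d (M ⋆ ⁅ u ⁆ ∖ u ⋆ X)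
      d-twists-¬∖ pM ¬pA with d-⋆∖-attained (proper-⋆∖ pM ¬pA)
      ... | Wb , Wb∈M , u∈Wb , dB≡ =
        d-⋆-≡ M X (≤-on-members _ absurd suc-d-⋆∖-≤) Wb Wb∈M
              (trans (sym (∣⊕⊕⁅⁆∣-∈ Wb X u u∉X u∈Wb)) (cong suc (sym dB≡))) ,
        d-⋆-≡ M (X ⊕ ⁅ u ⁆) (≤-on-members _ absurd d-⋆∖-≤) Wb Wb∈M (sym dB≡)
        where
        absurd : {A : Set} {W : Subset n} → W ∈M M → lookup W u ≡ false → A
        absurd W∈M u∉W = ⊥-elim (¬pA (_ , ∈-∖⁺ {S = M} u∉W W∈M))

      d-twists-Δ : IsDeltaMatroid M → Proper (M ∖ u) → Proper (M ⋆ ⁅ u ⁆ ∖ u) →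
                   d (M ⋆ X) ≡ d (M ∖ u ⋆ X) × d (M ⋆ (X ⊕ ⁅ u ⁆)) ≡ d (M ⋆ ⁅ u ⁆ ∖ u ⋆ X)
      d-twists-Δ dm pA pB with d-∖-attained pA | d-⋆∖-attained pB
      ... | Wa , Wa∈M , _ , dA≡ | Wb , Wb∈M , _ , dB≡ =
        d-⋆-≡ M X (≤-on-members _ d-∖-≤
                     (λ W∈M u∈W → ≤-trans (d-∖-≤-suc-d-⋆∖ dm pA pB) (suc-d-⋆∖-≤ W∈M u∈W)))
              Wa Wa∈M (sym dA≡) ,
        d-⋆-≡ M (X ⊕ ⁅ u ⁆) (≤-on-members _
                     (λ W∈M u∉W → ≤-trans (d-⋆∖-≤-suc-d-∖ dm pA pB) (suc-d-∖-≤ W∈M u∉W)) d-⋆∖-≤)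
              Wb Wb∈M (sym dB≡)

-- Sums over subsets

module Sums {c ℓ : Level} (R : CommutativeSemiring c ℓ) where

  open CommutativeSemiring R hiding (zero)
    renaming (refl to ≈-refl; sym to ≈-sym; trans to ≈-trans; reflexive to ≈-reflexive)
  open import Algebra.Properties.CommutativeSemigroup +-commutativeSemigroup using (interchange)
  open import Relation.Binary.Reasoning.Setoid setoid

  ∑ : {A : Set} → List A → (A → Carrier) → Carrier
  ∑ xs f = foldr (λ x acc → f x + acc) 0# xs

  module _ {A : Set} where

    ∑-cong : (xs : List A) {f g : A → Carrier} → (∀ x → f x ≈ g x) → ∑ xs f ≈ ∑ xs g
    ∑-cong []       f≈g = ≈-refl
    ∑-cong (x ∷ xs) f≈g = +-cong (f≈g x) (∑-cong xs f≈g)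

    ∑-++ : (xs ys : List A) (f : A → Carrier) → ∑ (xs ++ ys) f ≈ ∑ xs f + ∑ ys f
    ∑-++ []       ys f = ≈-sym (+-identityˡ _)
    ∑-++ (x ∷ xs) ys f = ≈-trans (+-congˡ (∑-++ xs ys f)) (≈-sym (+-assoc _ _ _))

    ∑-zero : (xs : List A) → ∑ xs (λ _ → 0#) ≈ 0#
    ∑-zero []       = ≈-refl
    ∑-zero (x ∷ xs) = ≈-trans (+-identityˡ _) (∑-zero xs)

    ∑-distrib-+ : (xs : List A) (f g : A → Carrier) → ∑ xs (λ x → f x + g x) ≈ ∑ xs f + ∑ xs g
    ∑-distrib-+ []       f g = ≈-sym (+-identityˡ _)
    ∑-distrib-+ (x ∷ xs) f g = ≈-trans (+-congˡ (∑-distrib-+ xs f g)) (interchange (f x) (g x) _ _)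

    ∑-distribˡ : (xs : List A) (k : Carrier) (f : A → Carrier) → ∑ xs (λ x → k * f x) ≈ k * ∑ xs f
    ∑-distribˡ []       k f = ≈-sym (zeroʳ k)
    ∑-distribˡ (x ∷ xs) k f = ≈-trans (+-congˡ (∑-distribˡ xs k f)) (≈-sym (distribˡ k _ _))

    ∑-filterᵇ : (p : A → Bool) (xs : List A) (f : A → Carrier) →
                ∑ (filterᵇ p xs) f ≈ ∑ xs (λ x → if p x then f x else 0#)
    ∑-filterᵇ p []       f = ≈-refl
    ∑-filterᵇ p (x ∷ xs) f with p x
    ... | true  = +-congˡ (∑-filterᵇ p xs f)
    ... | false = ≈-trans (∑-filterᵇ p xs f) (≈-sym (+-identityˡ _))

  ∑-allSubsets-suc : (g : Subset (suc n) → Carrier) →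
                     ∑ (allSubsets (suc n)) g ≈ ∑ (allSubsets n) (g ∘ (inside ∷_)) + ∑ (allSubsets n) (g ∘ (outside ∷_))
  ∑-allSubsets-suc {n} g = begin
    ∑ (map (inside ∷_) (allSubsets n) ++ map (outside ∷_) (allSubsets n)) g
      ≈⟨ ∑-++ (map (inside ∷_) (allSubsets n)) _ g ⟩
    ∑ (map (inside ∷_) (allSubsets n)) g + ∑ (map (outside ∷_) (allSubsets n)) g
      ≡⟨ cong₂ _+_ (foldr-map _ (inside ∷_) 0# (allSubsets n)) (foldr-map _ (outside ∷_) 0# (allSubsets n)) ⟩
    ∑ (allSubsets n) (g ∘ (inside ∷_)) + ∑ (allSubsets n) (g ∘ (outside ∷_))
      ∎

  pairUp : Fin n → (Subset n → Carrier) → Subset n → Carrier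
  pairUp u g X = if lookup X u then 0# else g X + g (X ⊕ ⁅ u ⁆)

  ∑-pairUp : (u : Fin n) (g : Subset n → Carrier) → ∑ (allSubsets n) g ≈ ∑ (allSubsets n) (pairUp u g)
  ∑-pairUp {suc n} zero g = begin
    ∑ (allSubsets (suc n)) g
      ≈⟨ ∑-allSubsets-suc g ⟩
    ∑ all (g ∘ (inside ∷_)) + ∑ all (g ∘ (outside ∷_))
      ≈⟨ +-comm _ _ ⟩
    ∑ all (g ∘ (outside ∷_)) + ∑ all (g ∘ (inside ∷_))
      ≈⟨ ∑-distrib-+ all _ _ ⟨
    ∑ all (λ X → g (outside ∷ X) + g (inside ∷ X))
      ≈⟨ ∑-cong all (λ X → +-congˡ (≈-reflexive (cong (g ∘ (inside ∷_)) (sym (⊕-identityʳ X))))) ⟩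
    ∑ all (λ X → g (outside ∷ X) + g (inside ∷ (X ⊕ ⊥)))
      ≈⟨ +-identityˡ _ ⟨
    0# + ∑ all (λ X → g (outside ∷ X) + g (inside ∷ (X ⊕ ⊥)))
      ≈⟨ +-congʳ (∑-zero all) ⟨
    ∑ all (λ _ → 0#) + ∑ all (λ X → g (outside ∷ X) + g (inside ∷ (X ⊕ ⊥)))
      ≈⟨ ∑-allSubsets-suc (pairUp zero g) ⟨
    ∑ (allSubsets (suc n)) (pairUp zero g)
      ∎
    where all = allSubsets n
  ∑-pairUp {suc n} (suc u) g = begin
    ∑ (allSubsets (suc n)) g
      ≈⟨ ∑-allSubsets-suc g ⟩
    ∑ (allSubsets n) (g ∘ (inside ∷_)) + ∑ (allSubsets n) (g ∘ (outside ∷_))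
      ≈⟨ +-cong (∑-pairUp u _) (∑-pairUp u _) ⟩
    ∑ (allSubsets n) (pairUp u (g ∘ (inside ∷_))) + ∑ (allSubsets n) (pairUp u (g ∘ (outside ∷_)))
      ≈⟨ ∑-allSubsets-suc (pairUp (suc u) g) ⟨
    ∑ (allSubsets (suc n)) (pairUp (suc u) g)
      ∎

  module _ (u : Fin n) {g : Subset n → Carrier} where

    ∑-by-pairs-* : (k : Carrier) {h : Subset n → Carrier} →
                   (∀ X → lookup X u ≡ false → g X + g (X ⊕ ⁅ u ⁆) ≈ k * (h X + h (X ⊕ ⁅ u ⁆))) →
                   ∑ (allSubsets n) g ≈ k * ∑ (allSubsets n) h
    ∑-by-pairs-* k {h} pairs = begin
      ∑ (allSubsets n) g                             ≈⟨ ∑-pairUp u g ⟩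
      ∑ (allSubsets n) (pairUp u g)                  ≈⟨ ∑-cong (allSubsets n) pointwise ⟩
      ∑ (allSubsets n) (λ X → k * pairUp u h X)      ≈⟨ ∑-distribˡ (allSubsets n) k _ ⟩
      k * ∑ (allSubsets n) (pairUp u h)              ≈⟨ *-congˡ (∑-pairUp u h) ⟨
      k * ∑ (allSubsets n) h                         ∎
      where
      pointwise : ∀ X → pairUp u g X ≈ k * pairUp u h X
      pointwise X with lookup X u in u∉X
      ... | true  = ≈-sym (zeroʳ k)
      ... | false = pairs X u∉X

    ∑-by-pairs-+ : {h₁ h₂ : Subset n → Carrier} →
                   (∀ X → lookup X u ≡ false →
                      g X + g (X ⊕ ⁅ u ⁆) ≈ (h₁ X + h₁ (X ⊕ ⁅ u ⁆)) + (h₂ X + h₂ (X ⊕ ⁅ u ⁆))) →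
                   ∑ (allSubsets n) g ≈ ∑ (allSubsets n) h₁ + ∑ (allSubsets n) h₂
    ∑-by-pairs-+ {h₁} {h₂} pairs = begin
      ∑ (allSubsets n) g                                        ≈⟨ ∑-pairUp u g ⟩
      ∑ (allSubsets n) (pairUp u g)                             ≈⟨ ∑-cong (allSubsets n) pointwise ⟩
      ∑ (allSubsets n) (λ X → pairUp u h₁ X + pairUp u h₂ X)    ≈⟨ ∑-distrib-+ (allSubsets n) _ _ ⟩
      ∑ (allSubsets n) (pairUp u h₁) + ∑ (allSubsets n) (pairUp u h₂)
        ≈⟨ +-cong (∑-pairUp u h₁) (∑-pairUp u h₂) ⟨
      ∑ (allSubsets n) h₁ + ∑ (allSubsets n) h₂                 ∎
      where
      pointwise : ∀ X → pairUp u g X ≈ pairUp u h₁ X + pairUp u h₂ X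
      pointwise X with lookup X u in u∉X
      ... | true  = ≈-sym (+-identityʳ 0#)
      ... | false = pairs X u∉X

-- The polynomial q₁

module Q₁ {c ℓ : Level} (R : CommutativeSemiring c ℓ) (y : CommutativeSemiring.Carrier R) where

  open CommutativeSemiring R hiding (zero)
    renaming (refl to ≈-refl; sym to ≈-sym; trans to ≈-trans; reflexive to ≈-reflexive)
  open Poly R
  open Sums R
  open import Relation.Binary.Reasoning.Setoid setoid

  when : Bool → Carrier → Carrier
  when b x = if b then x else 0#

  when-cong : (b : Bool) {x z : Carrier} → x ≈ z → when b x ≈ when b z
  when-cong true  x≈z = x≈z
  when-cong false _   = ≈-refl

  when-+ : (b : Bool) (x z : Carrier) → when b (x + z) ≈ when b x + when b z
  when-+ true  x z = ≈-refl
  when-+ false x z = ≈-sym (+-identityʳ 0#)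

  when-* : (b : Bool) (k x : Carrier) → when b (k * x) ≈ k * when b x
  when-* true  k x = ≈-refl
  when-* false k x = ≈-sym (zeroʳ k)

  pow-+-pow-suc : (k : ℕ) → pow y k + pow y (suc k) ≈ (y + 1#) * pow y k
  pow-+-pow-suc k = begin
    pow y k + y * pow y k       ≈⟨ +-comm _ _ ⟩
    y * pow y k + pow y k       ≈⟨ +-congˡ (*-identityˡ _) ⟨
    y * pow y k + 1# * pow y k  ≈⟨ distribʳ _ _ _ ⟨
    (y + 1#) * pow y k          ∎

  term : SetSystem n → Subset n → Carrier
  term S X = when (X ⊆ᵇ V S) (pow y (d (S ⋆ X)))

  q₁≈∑term : (S : SetSystem n) → q₁ y S ≈ ∑ (allSubsets n) (term S)
  q₁≈∑term {n} S = ∑-filterᵇ (_⊆ᵇ V S) (allSubsets n) (λ X → pow y (d (S ⋆ X)))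

  module _ (M : SetSystem n) (u : Fin n) {X : Subset n} (u∉X : lookup X u ≡ false) where

    term-pair : lookup (V M) u ≡ true →
                term M X + term M (X ⊕ ⁅ u ⁆) ≈ when (X ⊆ᵇ V M) (pow y (d (M ⋆ X)) + pow y (d (M ⋆ (X ⊕ ⁅ u ⁆))))
    term-pair u∈V = begin
      when (X ⊆ᵇ V M) a + when ((X ⊕ ⁅ u ⁆) ⊆ᵇ V M) b
        ≡⟨ cong (λ s → when (X ⊆ᵇ V M) a + when s b) (⊆ᵇ-⊕⁅⁆ X (V M) u u∉X u∈V) ⟩
      when (X ⊆ᵇ V M) a + when (X ⊆ᵇ V M) b
        ≈⟨ when-+ (X ⊆ᵇ V M) a b ⟨
      when (X ⊆ᵇ V M) (a + b) ∎
      where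
      a = pow y (d (M ⋆ X))
      b = pow y (d (M ⋆ (X ⊕ ⁅ u ⁆)))

    term-pair-minor : (N : SetSystem n) → V N ≡ V M - u →
                      term N X + term N (X ⊕ ⁅ u ⁆) ≈ when (X ⊆ᵇ V M) (pow y (d (N ⋆ X)))
    term-pair-minor N VN≡ = begin
      when (X ⊆ᵇ V N) a + when ((X ⊕ ⁅ u ⁆) ⊆ᵇ V N) b
        ≡⟨ cong₂ (λ s t → when s a + when t b)
                   (trans (cong (X ⊆ᵇ_) VN≡) (⊆ᵇ-remove X (V M) u u∉X))
                   (trans (cong ((X ⊕ ⁅ u ⁆) ⊆ᵇ_) VN≡) (⊕⁅⁆-⊆ᵇ-remove X (V M) u u∉X)) ⟩
      when (X ⊆ᵇ V M) a + 0#
        ≈⟨ +-identityʳ _ ⟩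
      when (X ⊆ᵇ V M) a ∎
      where
      a = pow y (d (N ⋆ X))
      b = pow y (d (N ⋆ (X ⊕ ⁅ u ⁆)))

    term-pair-* : lookup (V M) u ≡ true → (N : SetSystem n) → V N ≡ V M - u → (k : Carrier) →
                  pow y (d (M ⋆ X)) + pow y (d (M ⋆ (X ⊕ ⁅ u ⁆))) ≈ k * pow y (d (N ⋆ X)) →
                  term M X + term M (X ⊕ ⁅ u ⁆) ≈ k * (term N X + term N (X ⊕ ⁅ u ⁆))
    term-pair-* u∈V N VN≡ k powers = begin
      term M X + term M (X ⊕ ⁅ u ⁆)                 ≈⟨ term-pair u∈V ⟩
      when (X ⊆ᵇ V M) (_ + _)                       ≈⟨ when-cong (X ⊆ᵇ V M) powers ⟩
      when (X ⊆ᵇ V M) (k * pow y (d (N ⋆ X)))       ≈⟨ when-* (X ⊆ᵇ V M) k _ ⟩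
      k * when (X ⊆ᵇ V M) (pow y (d (N ⋆ X)))       ≈⟨ *-congˡ (term-pair-minor N VN≡) ⟨
      k * (term N X + term N (X ⊕ ⁅ u ⁆))           ∎

    term-pair-+ : lookup (V M) u ≡ true → (N₁ N₂ : SetSystem n) → V N₁ ≡ V M - u → V N₂ ≡ V M - u →
                  pow y (d (M ⋆ X)) + pow y (d (M ⋆ (X ⊕ ⁅ u ⁆))) ≈ pow y (d (N₁ ⋆ X)) + pow y (d (N₂ ⋆ X)) →
                  term M X + term M (X ⊕ ⁅ u ⁆) ≈
                    (term N₁ X + term N₁ (X ⊕ ⁅ u ⁆)) + (term N₂ X + term N₂ (X ⊕ ⁅ u ⁆))
    term-pair-+ u∈V N₁ N₂ VN₁≡ VN₂≡ powers = begin
      term M X + term M (X ⊕ ⁅ u ⁆)                 ≈⟨ term-pair u∈V ⟩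
      when (X ⊆ᵇ V M) (_ + _)                       ≈⟨ when-cong (X ⊆ᵇ V M) powers ⟩
      when (X ⊆ᵇ V M) (pow y (d (N₁ ⋆ X)) + pow y (d (N₂ ⋆ X)))
        ≈⟨ when-+ (X ⊆ᵇ V M) _ _ ⟩
      when (X ⊆ᵇ V M) (pow y (d (N₁ ⋆ X))) + when (X ⊆ᵇ V M) (pow y (d (N₂ ⋆ X)))
        ≈⟨ +-cong (term-pair-minor N₁ VN₁≡) (term-pair-minor N₂ VN₂≡) ⟨
      (term N₁ X + term N₁ (X ⊕ ⁅ u ⁆)) + (term N₂ X + term N₂ (X ⊕ ⁅ u ⁆)) ∎

  module _ {n : ℕ} (M : SetSystem n) (u : Fin n) (u∈V : lookup (V M) u ≡ true) where

    q₁-¬⋆∖ : Proper M → ¬ Proper (M ⋆ ⁅ u ⁆ ∖ u) → q₁ y M ≈ (y + 1#) * q₁ y (M ∖ u)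
    q₁-¬⋆∖ pM ¬pB = begin
      q₁ y M                                      ≈⟨ q₁≈∑term M ⟩
      ∑ (allSubsets n) (term M)                   ≈⟨ ∑-by-pairs-* u (y + 1#) pairs ⟩
      (y + 1#) * ∑ (allSubsets n) (term (M ∖ u))  ≈⟨ *-congˡ (q₁≈∑term (M ∖ u)) ⟨
      (y + 1#) * q₁ y (M ∖ u)                     ∎
      where
      pairs : ∀ X → lookup X u ≡ false →
              term M X + term M (X ⊕ ⁅ u ⁆) ≈ (y + 1#) * (term (M ∖ u) X + term (M ∖ u) (X ⊕ ⁅ u ⁆))
      pairs X u∉X =
        let dX≡ , dXᵘ≡ = d-twists-¬⋆∖ M u X u∉X pM ¬pB in
        term-pair-* M u u∉X u∈V (M ∖ u) refl (y + 1#)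
        (≈-trans (≈-reflexive (cong₂ (λ p q → pow y p + pow y q) dX≡ dXᵘ≡)) (pow-+-pow-suc (d (M ∖ u ⋆ X))))

    q₁-¬∖ : Proper M → ¬ Proper (M ∖ u) → q₁ y M ≈ (y + 1#) * q₁ y (M ⋆ ⁅ u ⁆ ∖ u)
    q₁-¬∖ pM ¬pA = begin
      q₁ y M                                               ≈⟨ q₁≈∑term M ⟩
      ∑ (allSubsets n) (term M)                            ≈⟨ ∑-by-pairs-* u (y + 1#) pairs ⟩
      (y + 1#) * ∑ (allSubsets n) (term (M ⋆ ⁅ u ⁆ ∖ u))   ≈⟨ *-congˡ (q₁≈∑term (M ⋆ ⁅ u ⁆ ∖ u)) ⟨
      (y + 1#) * q₁ y (M ⋆ ⁅ u ⁆ ∖ u)                      ∎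
      where
      pairs : ∀ X → lookup X u ≡ false →
              term M X + term M (X ⊕ ⁅ u ⁆) ≈
                (y + 1#) * (term (M ⋆ ⁅ u ⁆ ∖ u) X + term (M ⋆ ⁅ u ⁆ ∖ u) (X ⊕ ⁅ u ⁆))
      pairs X u∉X =
        let dX≡ , dXᵘ≡ = d-twists-¬∖ M u X u∉X pM ¬pA
            b = d (M ⋆ ⁅ u ⁆ ∖ u ⋆ X) in
        term-pair-* M u u∉X u∈V (M ⋆ ⁅ u ⁆ ∖ u) refl (y + 1#)
        (≈-trans (≈-reflexive (cong₂ (λ p q → pow y p + pow y q) dX≡ dXᵘ≡))
               (≈-trans (+-comm (pow y (suc b)) (pow y b)) (pow-+-pow-suc b)))

    q₁-Δ : IsDeltaMatroid M → Proper (M ∖ u) → Proper (M ⋆ ⁅ u ⁆ ∖ u) →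
           q₁ y M ≈ q₁ y (M ∖ u) + q₁ y (M ⋆ ⁅ u ⁆ ∖ u)
    q₁-Δ dm pA pB = begin
      q₁ y M                                        ≈⟨ q₁≈∑term M ⟩
      ∑ (allSubsets n) (term M)                     ≈⟨ ∑-by-pairs-+ u pairs ⟩
      ∑ (allSubsets n) (term (M ∖ u)) + ∑ (allSubsets n) (term (M ⋆ ⁅ u ⁆ ∖ u))
        ≈⟨ +-cong (q₁≈∑term (M ∖ u)) (q₁≈∑term (M ⋆ ⁅ u ⁆ ∖ u)) ⟨
      q₁ y (M ∖ u) + q₁ y (M ⋆ ⁅ u ⁆ ∖ u)           ∎
      where
      pairs : ∀ X → lookup X u ≡ false →
              term M X + term M (X ⊕ ⁅ u ⁆) ≈
                (term (M ∖ u) X + term (M ∖ u) (X ⊕ ⁅ u ⁆))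
                  + (term (M ⋆ ⁅ u ⁆ ∖ u) X + term (M ⋆ ⁅ u ⁆ ∖ u) (X ⊕ ⁅ u ⁆))
      pairs X u∉X =
        let dX≡ , dXᵘ≡ = d-twists-Δ M u X u∉X dm pA pB in
        term-pair-+ M u u∉X u∈V (M ∖ u) (M ⋆ ⁅ u ⁆ ∖ u) refl refl
        (≈-reflexive (cong₂ (λ p q → pow y p + pow y q) dX≡ dXᵘ≡))

  ∑-⊆ᵇ⊥ : (f : Subset n → Carrier) → ∑ (allSubsets n) (λ X → when (X ⊆ᵇ ⊥) (f X)) ≈ f ⊥
  ∑-⊆ᵇ⊥ {zero}  f = +-identityʳ _
  ∑-⊆ᵇ⊥ {suc n} f = begin
    ∑ (allSubsets (suc n)) (λ X → when (X ⊆ᵇ ⊥) (f X))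
      ≈⟨ ∑-allSubsets-suc {n} (λ X → when (X ⊆ᵇ ⊥) (f X)) ⟩
    ∑ (allSubsets n) (λ _ → 0#) + ∑ (allSubsets n) (λ X → when (X ⊆ᵇ ⊥) (f (outside ∷ X)))
      ≈⟨ +-cong (∑-zero (allSubsets n)) (∑-⊆ᵇ⊥ (f ∘ (outside ∷_))) ⟩
    0# + f ⊥
      ≈⟨ +-identityˡ _ ⟩
    f ⊥ ∎

  q₁-⊥ : (M : SetSystem n) → V M ≡ ⊥ → ⊥ ∈M M → q₁ y M ≈ 1#
  q₁-⊥ {n} M V≡⊥ ⊥∈M = begin
    q₁ y M                                                   ≈⟨ q₁≈∑term M ⟩
    ∑ (allSubsets n) (λ X → when (X ⊆ᵇ V M) (pow y (d (M ⋆ X))))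
      ≡⟨ cong (λ W → ∑ (allSubsets n) (λ X → when (X ⊆ᵇ W) (pow y (d (M ⋆ X))))) V≡⊥ ⟩
    ∑ (allSubsets n) (λ X → when (X ⊆ᵇ ⊥) (pow y (d (M ⋆ X)))) ≈⟨ ∑-⊆ᵇ⊥ (λ X → pow y (d (M ⋆ X))) ⟩
    pow y (d (M ⋆ ⊥))                                        ≡⟨ cong (pow y) d≡0 ⟩
    1#                                                       ∎
    where
    d≡0 : d (M ⋆ ⊥) ≡ 0
    d≡0 = n≤0⇒n≡0 (subst (d (M ⋆ ⊥) ≤_) (trans (cong ∣_∣ (⊕-identityˡ {n} ⊥)) (∣⊥∣≡0 n)) (d-⋆-≤ M ⊥ ⊥∈M))

corollary23 : {c ℓ : Level} (R : CommutativeSemiring c ℓ) (y : CommutativeSemiring.Carrier R)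
    {n : ℕ} (M : SetSystem n) → IsDeltaMatroid M →
    let open CommutativeSemiring R
        open Poly R
    in ((u : Fin n) → u ∈ V M →
          (¬ Proper (M ⋆ ⁅ u ⁆ ∖ u) → q₁ y M ≈ (y + 1#) * q₁ y (M ∖ u))
          × (¬ Proper (M ∖ u) → q₁ y M ≈ (y + 1#) * q₁ y (M ⋆ ⁅ u ⁆ ∖ u))
          × (Proper (M ∖ u) → Proper (M ⋆ ⁅ u ⁆ ∖ u) →
               q₁ y M ≈ q₁ y (M ∖ u) + q₁ y (M ⋆ ⁅ u ⁆ ∖ u)))
       × (V M ≡ ⊥ → ((Z : Subset n) → (Z ∈M M → Z ≡ ⊥) × (Z ≡ ⊥ → Z ∈M M)) → q₁ y M ≈ 1#)
corollary23 R y M dm =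
  (λ u u∈V → let u∈V′ = []=⇒lookup u∈V in
    q₁-¬⋆∖ M u u∈V′ proper , q₁-¬∖ M u u∈V′ proper , q₁-Δ M u u∈V′ dm) ,
  -- The base case only needs ∅ ∈ M, not that ∅ is the only member.
  λ V≡⊥ members → q₁-⊥ M V≡⊥ (proj₂ (members ⊥) refl)
  where
  open Q₁ R y
  open IsDeltaMatroid dm using (proper)
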